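{- Let $H$ be a connected simple graph with maximum degree exactly $3$ and with $n_H(C_3)\geq 2$ triangles. Then the number of vertices of $H$ of degree $3$ is at least $n_H(C_3)$. -}

module Defs where

open import Data.Nat using (ℕ; _≤_; _<_; _≟_)
open import Data.Bool using (Bool; true; false; T; _∧_)
open import Data.Fin using (Fin) renaming (_<_ to _<ᶠ_)
open import Data.Fin.Properties using (_<?_)
open import Data.List using (List; []; _∷_; length; filter; allFin; map)
open import Data.Nat.ListAction using (sum)
open import Data.Product using (Σ; ∃; _×_; _,_)
open import Relation.Nullary using (¬_; Dec; yes; no)
open import Relation.Nullary.Decidable using (⌊_⌋)
open import Relation.Binary.PropositionalEquality using (_≡_)

record Graph (n : ℕ) : Set where
  field
    adj   : Fin n → Fin n → Bool
    sym   : ∀ u v → adj u v ≡ adj v u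
    irrefl : ∀ v → adj v v ≡ false

open Graph public

Adj : ∀ {n} → Graph n → Fin n → Fin n → Set
Adj G u v = T (adj G u v)

countFin : ∀ {n} → (Fin n → Bool) → ℕ
countFin {n} p = length (filter (λ i → T? (p i)) (allFin n))
  where
  T? : (b : Bool) → Dec (T b)
  T? true  = yes _
  T? false = no (λ ())

degree : ∀ {n} → Graph n → Fin n → ℕ
degree G v = countFin (adj G v)

data Walk {n} (G : Graph n) : Fin n → Fin n → Set where
  here : ∀ {v} → Walk G v v
  step : ∀ {u w v} → Adj G u w → Walk G w v → Walk G u v

Connected : ∀ {n} → Graph n → Set
Connected {n} G = Fin n × (∀ u v → Walk G u v)

MaxDegree : ∀ {n} → Graph n → ℕ → Set
MaxDegree G d = (∀ v → degree G v ≤ d) × ∃ λ v → degree G v ≡ d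

isTriangle : ∀ {n} → Graph n → Fin n → Fin n → Fin n → Bool
isTriangle G i j k =
  ⌊ i <? j ⌋ ∧ ⌊ j <? k ⌋ ∧ adj G i j ∧ adj G j k ∧ adj G i k

numTriangles : ∀ {n} → Graph n → ℕ
numTriangles {n} G =
  sum (map (λ i → sum (map (λ j → countFin (isTriangle G i j)) (allFin n))) (allFin n))

numDegree : ∀ {n} → Graph n → ℕ → ℕ
numDegree G d = countFin (λ v → ⌊ degree G v ≟ d ⌋)

-- Discharging. Every triangle gets charge 6, shared equally by its κ vertices of degree 3 (w κ = 6 / κ
-- each). This is possible because every triangle has such a vertex: a triangle of vertices of degree at
-- most 2 is a whole component, while the graph is connected and has a vertex of degree 3. A vertex v of
-- degree 3 with neighbours a, b, c lies exactly on the triangles v x y with x y an edge among a, b, c,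
-- and receives at most 6: one such triangle gives at most 6; two of them share a neighbour, which then
-- has degree 3, so each gives at most 3; three of them make a K₄, giving 2 each.
-- Hence 6 · #triangles ≤ 6 · #(vertices of degree 3).
module Submission where

open import Algebra.Properties.CommutativeSemigroup using (x∙yz≈y∙xz; xy∙z≈xz∙y)
open import Data.Bool using (Bool; true; false; T; _∧_)
open import Data.Bool.Properties using (T-∧)
open import Data.Empty using (⊥; ⊥-elim)
open import Data.Fin using (Fin; zero; suc) renaming (_<_ to _<ᶠ_)
open import Data.Fin.Properties using (_≟_; _<?_; <-cmp; <-irrefl; <-asym; <-trans)
open import Data.List using (List; []; _∷_; map; allFin; tabulate; filter; length)
open import Data.List.Membership.Propositional using (_∈_; _∉_)
open import Data.List.Membership.Propositional.Properties using (∈-filter⁺; ∈-filter⁻; ∈-allFin)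
open import Data.List.Properties using (map-tabulate; map-cong; map-cong-local; filter-≐)
open import Data.List.Relation.Unary.All as All using (All; []; _∷_)
open import Data.List.Relation.Unary.Any using (here; there)
open import Data.List.Relation.Unary.Unique.Propositional using (Unique; []; _∷_)
open import Data.List.Relation.Unary.Unique.Propositional.Properties using (filter⁺; allFin⁺)
open import Data.Nat using (ℕ; zero; suc; _+_; _*_; _≤_; z≤n; s≤s) renaming (_≟_ to _≟ℕ_)
open import Data.Nat.ListAction using () renaming (sum to sumₗ)
open import Data.Nat.Properties
  using ( +-*-semiring; +-commutativeSemigroup; +-assoc; +-comm; +-identityʳ; *-zeroʳ; *-identityˡ
        ; *-assoc; *-comm; *-distribˡ-+; *-distribʳ-+; ≤-refl; ≤-trans; ≤-antisym; m≤m+n; 0≢1+n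
        ; +-mono-≤; +-monoˡ-≤; *-monoˡ-≤; *-monoʳ-≤; *-cancelˡ-≤; module ≤-Reasoning )
open import Data.Nat.Tactic.RingSolver using (solve-∀)
open import Data.Product using (_×_; _,_; proj₁; proj₂; ∃-syntax)
open import Data.Sum using (_⊎_; inj₁; inj₂; map₂)
open import Data.Vec.Functional using (updateAt)
open import Data.Vec.Functional.Properties using (updateAt-updates; updateAt-minimal)
open import Function using (_∘_; const; id)
open import Function.Bundles using (Equivalence)
open import Relation.Binary using (tri<; tri≈; tri>)
open import Relation.Binary.PropositionalEquality
open import Relation.Nullary using (yes; no)
open import Relation.Nullary.Decidable using (T?; ⌊_⌋; fromWitness)

open import Algebra.Properties.Semiring.Sum +-*-semiring
open import Defs renaming (sym to adj-sym; irrefl to adj-irrefl)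

open ≤-Reasoning

𝟙 : Bool → ℕ
𝟙 true  = 1
𝟙 false = 0

𝟙-∧ : ∀ x y → 𝟙 (x ∧ y) ≡ 𝟙 x * 𝟙 y
𝟙-∧ true  y = sym (+-identityʳ (𝟙 y))
𝟙-∧ false y = refl

𝟙-*-≤ : ∀ b {m o} → m ≤ o → 𝟙 b * m ≤ o
𝟙-*-≤ false _   = z≤n
𝟙-*-≤ true  m≤o = subst (_≤ _) (sym (+-identityʳ _)) m≤o

T⇒1≤𝟙 : ∀ {r} → T r → 1 ≤ 𝟙 r
T⇒1≤𝟙 {true} _ = s≤s z≤n

𝟙-at-most-one-≤ : ∀ {x y z r} → (T x → T r) → (T y → T r) → (T z → T r) →
                  (T x → T y → ⊥) → (T x → T z → ⊥) → (T y → T z → ⊥) → 𝟙 x + 𝟙 y + 𝟙 z ≤ 𝟙 r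
𝟙-at-most-one-≤ {false} {false} {false} _   _   _   _   _   _   = z≤n
𝟙-at-most-one-≤ {true}  {false} {false} x⇒r _   _   _   _   _   = T⇒1≤𝟙 (x⇒r _)
𝟙-at-most-one-≤ {false} {true}  {false} _   y⇒r _   _   _   _   = T⇒1≤𝟙 (y⇒r _)
𝟙-at-most-one-≤ {false} {false} {true}  _   _   z⇒r _   _   _   = T⇒1≤𝟙 (z⇒r _)
𝟙-at-most-one-≤ {true}  {true}          _   _   _   x∧y _   _   = ⊥-elim (x∧y _ _)
𝟙-at-most-one-≤ {true}  {false} {true}  _   _   _   _   x∧z _   = ⊥-elim (x∧z _ _)
𝟙-at-most-one-≤ {false} {true}  {true}  _   _   _   _   _   y∧z = ⊥-elim (y∧z _ _)

≤1⇒*-monoʳ-≤ : ∀ {d m o} → d ≤ 1 → (d ≡ 1 → m ≤ o) → d * m ≤ d * o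
≤1⇒*-monoʳ-≤ z≤n       _   = z≤n
≤1⇒*-monoʳ-≤ (s≤s z≤n) m≤o = *-monoʳ-≤ 1 (m≤o refl)

+-mono₃-≤ : ∀ {x y z} a b c → x ≤ a → y ≤ b → z ≤ c → x + y + z ≤ a + b + c
+-mono₃-≤ a b c x≤a y≤b z≤c = +-mono-≤ (+-mono-≤ x≤a y≤b) z≤c

sum-mono-≤ : ∀ {n} {f g : Fin n → ℕ} → (∀ i → f i ≤ g i) → sum f ≤ sum g
sum-mono-≤ {zero}  f≤g = z≤n
sum-mono-≤ {suc n} f≤g = +-mono-≤ (f≤g zero) (sum-mono-≤ (f≤g ∘ suc))

sum-zero : ∀ {n} {f : Fin n → ℕ} → (∀ i → f i ≡ 0) → sum f ≡ 0
sum-zero {n} f≡0 = trans (sum-cong-≗ f≡0) (sum-replicate-zero n)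

sumₗ-allFin : ∀ {n} (f : Fin n → ℕ) → sumₗ (map f (allFin n)) ≡ sum f
sumₗ-allFin {n} f = trans (cong sumₗ (map-tabulate id f)) (sumₗ-tabulate f)
  where
  sumₗ-tabulate : ∀ {m} (g : Fin m → ℕ) → sumₗ (tabulate g) ≡ sum g
  sumₗ-tabulate {zero}  g = refl
  sumₗ-tabulate {suc m} g = cong (g zero +_) (sumₗ-tabulate (g ∘ suc))

sum-updateAt-0 : ∀ {n} (a : Fin n) (f : Fin n → ℕ) → sum f ≡ f a + sum (updateAt f a (const 0))
sum-updateAt-0 {suc n} zero    f = refl
sum-updateAt-0 {suc n} (suc a) f = begin-equality
  f zero + sum (f ∘ suc)
    ≡⟨ cong (f zero +_) (sum-updateAt-0 a (f ∘ suc)) ⟩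
  f zero + (f (suc a) + sum (updateAt (f ∘ suc) a (const 0)))
    ≡⟨ x∙yz≈y∙xz +-commutativeSemigroup (f zero) (f (suc a)) _ ⟩
  f (suc a) + (f zero + sum (updateAt (f ∘ suc) a (const 0))) ∎

eraseAll : ∀ {n} → List (Fin n) → (Fin n → ℕ) → Fin n → ℕ
eraseAll []       f = f
eraseAll (a ∷ xs) f = eraseAll xs (updateAt f a (const 0))

sum-split : ∀ {n} {xs : List (Fin n)} → Unique xs → (f : Fin n → ℕ) →
            sum f ≡ sumₗ (map f xs) + sum (eraseAll xs f)
sum-split []                         f = refl
sum-split {xs = a ∷ xs} (a∉xs ∷ !xs) f = begin-equality
  sum f                                           ≡⟨ sum-updateAt-0 a f ⟩
  f a + sum f′                                    ≡⟨ cong (f a +_) (sum-split !xs f′) ⟩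
  f a + (sumₗ (map f′ xs) + sum (eraseAll xs f′))
    ≡⟨ cong (λ ys → f a + (sumₗ ys + sum (eraseAll xs f′))) f′≡f-on-xs ⟩
  f a + (sumₗ (map f xs) + sum (eraseAll xs f′))  ≡⟨ +-assoc (f a) _ _ ⟨
  sumₗ (map f (a ∷ xs)) + sum (eraseAll (a ∷ xs) f) ∎
  where
  f′ = updateAt f a (const 0)
  f′≡f-on-xs : map f′ xs ≡ map f xs
  f′≡f-on-xs = map-cong-local (All.map (λ a≢x → updateAt-minimal _ a f (a≢x ∘ sym)) a∉xs)

eraseAll-vanishes : ∀ {n} (xs : List (Fin n)) {f : Fin n → ℕ} →
                    (∀ x → x ∉ xs → f x ≡ 0) → ∀ x → eraseAll xs f x ≡ 0
eraseAll-vanishes []       f≡0 x = f≡0 x λ ()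
eraseAll-vanishes (a ∷ xs) {f} f≡0 = eraseAll-vanishes xs f′≡0
  where
  f′≡0 : ∀ x → x ∉ xs → updateAt f a (const 0) x ≡ 0
  f′≡0 x x∉xs with x ≟ a
  ... | yes refl = updateAt-updates a f
  ... | no  x≢a  =
    trans (updateAt-minimal x a f x≢a) (f≡0 x λ { (here x≡a) → x≢a x≡a ; (there x∈xs) → x∉xs x∈xs })

sumₗ-≤-sum : ∀ {n} {xs : List (Fin n)} → Unique xs → (f : Fin n → ℕ) → sumₗ (map f xs) ≤ sum f
sumₗ-≤-sum {xs = xs} !xs f = subst (sumₗ (map f xs) ≤_) (sym (sum-split !xs f)) (m≤m+n _ _)

sum-support : ∀ {n} {xs : List (Fin n)} → Unique xs → {f : Fin n → ℕ} →
              (∀ x → x ∉ xs → f x ≡ 0) → sum f ≡ sumₗ (map f xs)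
sum-support {xs = xs} !xs {f} f≡0 = begin-equality
  sum f                                 ≡⟨ sum-split !xs f ⟩
  sumₗ (map f xs) + sum (eraseAll xs f) ≡⟨ cong (sumₗ (map f xs) +_) (sum-zero (eraseAll-vanishes xs f≡0)) ⟩
  sumₗ (map f xs) + 0                   ≡⟨ +-identityʳ _ ⟩
  sumₗ (map f xs)                       ∎

sum²-distrib-+ : ∀ {n} (f g : Fin n → Fin n → ℕ) →
                 ∑[ j < n ] ∑[ k < n ] (f j k + g j k)
                 ≡ ∑[ j < n ] ∑[ k < n ] f j k + ∑[ j < n ] ∑[ k < n ] g j k
sum²-distrib-+ {n} f g =
  trans (sum-cong-≗ (λ j → ∑-distrib-+ (f j) (g j)))
        (∑-distrib-+ (λ j → ∑[ k < n ] f j k) (λ j → ∑[ k < n ] g j k))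

sum²-pull : ∀ {n} c (f : Fin n → Fin n → ℕ) →
            ∑[ j < n ] ∑[ k < n ] (c * f j k) ≡ c * ∑[ j < n ] ∑[ k < n ] f j k
sum²-pull {n} c f =
  trans (sum-cong-≗ (λ j → sym (*-distribˡ-sum c (f j)))) (sym (*-distribˡ-sum c (λ j → ∑[ k < n ] f j k)))

sum³ : ∀ {n} → (Fin n → Fin n → Fin n → ℕ) → ℕ
sum³ {n} f = ∑[ i < n ] ∑[ j < n ] ∑[ k < n ] f i j k

sum³-cong : ∀ {n} {f g : Fin n → Fin n → Fin n → ℕ} → (∀ i j k → f i j k ≡ g i j k) → sum³ f ≡ sum³ g
sum³-cong f≡g = sum-cong-≗ (λ i → sum-cong-≗ (λ j → sum-cong-≗ (f≡g i j)))

sum³-distrib-+ : ∀ {n} (f g : Fin n → Fin n → Fin n → ℕ) →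
                 sum³ (λ i j k → f i j k + g i j k) ≡ sum³ f + sum³ g
sum³-distrib-+ {n} f g =
  trans (sum-cong-≗ (λ i → sum²-distrib-+ (f i) (g i)))
        (∑-distrib-+ (λ i → ∑[ j < n ] ∑[ k < n ] f i j k) (λ i → ∑[ j < n ] ∑[ k < n ] g i j k))

sum³-pull : ∀ {n} c (f : Fin n → Fin n → Fin n → ℕ) → sum³ (λ i j k → c * f i j k) ≡ c * sum³ f
sum³-pull {n} c f =
  trans (sum-cong-≗ (λ i → sum²-pull c (f i))) (sym (*-distribˡ-sum c (λ i → ∑[ j < n ] ∑[ k < n ] f i j k)))

sum-redistribute : ∀ {n} (c : Fin n → ℕ) (f : Fin n → Fin n → Fin n → ℕ) →
  sum³ (λ i j k → (c i + c j + c k) * f i j k)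
  ≡ ∑[ v < n ] (c v * ∑[ j < n ] ∑[ k < n ] (f v j k + f j v k + f j k v))
sum-redistribute {n} c f = begin-equality
  sum³ (λ i j k → (c i + c j + c k) * f i j k)
    ≡⟨ sum³-cong distrib ⟩
  sum³ (λ i j k → cf₁ i j k + cf₂ i j k + cf₃ i j k)
    ≡⟨ trans (sum³-distrib-+ (λ i j k → cf₁ i j k + cf₂ i j k) cf₃)
             (cong (_+ sum³ cf₃) (sum³-distrib-+ cf₁ cf₂)) ⟩
  sum³ cf₁ + sum³ cf₂ + sum³ cf₃
    ≡⟨ cong₂ _+_ (cong₂ _+_ first second) third ⟩
  ∑[ v < n ] (c v * at₁ v) + ∑[ v < n ] (c v * at₂ v) + ∑[ v < n ] (c v * at₃ v)
    ≡⟨ trans (∑-distrib-+ (λ v → c v * at₁ v + c v * at₂ v) (λ v → c v * at₃ v))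
             (cong (_+ ∑[ v < n ] (c v * at₃ v)) (∑-distrib-+ (λ v → c v * at₁ v) (λ v → c v * at₂ v))) ⟨
  ∑[ v < n ] (c v * at₁ v + c v * at₂ v + c v * at₃ v)
    ≡⟨ sum-cong-≗ (λ v → trans (*-distribˡ-+ (c v) (at₁ v + at₂ v) (at₃ v))
                               (cong (_+ c v * at₃ v) (*-distribˡ-+ (c v) (at₁ v) (at₂ v)))) ⟨
  ∑[ v < n ] (c v * (at₁ v + at₂ v + at₃ v))
    ≡⟨ sum-cong-≗ (λ v → cong (c v *_) (rotations-split v)) ⟨
  ∑[ v < n ] (c v * ∑[ j < n ] ∑[ k < n ] (f v j k + f j v k + f j k v)) ∎
  where
  cf₁ cf₂ cf₃ : Fin n → Fin n → Fin n → ℕ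
  cf₁ i j k = c i * f i j k
  cf₂ i j k = c j * f i j k
  cf₃ i j k = c k * f i j k

  at₁ at₂ at₃ : Fin n → ℕ
  at₁ v = ∑[ j < n ] ∑[ k < n ] f v j k
  at₂ v = ∑[ j < n ] ∑[ k < n ] f j v k
  at₃ v = ∑[ j < n ] ∑[ k < n ] f j k v

  rotations-split : ∀ v → ∑[ j < n ] ∑[ k < n ] (f v j k + f j v k + f j k v) ≡ at₁ v + at₂ v + at₃ v
  rotations-split v = trans (sum²-distrib-+ (λ j k → f v j k + f j v k) (λ j k → f j k v))
                    (cong (_+ at₃ v) (sum²-distrib-+ (λ j k → f v j k) (λ j k → f j v k)))

  distrib : ∀ i j k → (c i + c j + c k) * f i j k ≡ cf₁ i j k + cf₂ i j k + cf₃ i j k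
  distrib i j k = trans (*-distribʳ-+ (f i j k) (c i + c j) (c k))
                        (cong (_+ cf₃ i j k) (*-distribʳ-+ (f i j k) (c i) (c j)))

  first : sum³ cf₁ ≡ ∑[ v < n ] (c v * at₁ v)
  first = sum-cong-≗ (λ i → sum²-pull (c i) (f i))

  second : sum³ cf₂ ≡ ∑[ v < n ] (c v * at₂ v)
  second = trans (∑-comm (λ i j → ∑[ k < n ] cf₂ i j k))
                 (sum-cong-≗ (λ j → sum²-pull (c j) (λ i k → f i j k)))

  third : sum³ cf₃ ≡ ∑[ v < n ] (c v * at₃ v)
  third = begin-equality
    sum³ cf₃                                    ≡⟨ sum-cong-≗ (λ i → ∑-comm (cf₃ i)) ⟩
    ∑[ i < n ] ∑[ k < n ] ∑[ j < n ] cf₃ i j k  ≡⟨ ∑-comm (λ i k → ∑[ j < n ] cf₃ i j k) ⟩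
    ∑[ k < n ] ∑[ i < n ] ∑[ j < n ] cf₃ i j k  ≡⟨ sum-cong-≗ (λ k → sum²-pull (c k) (λ i j → f i j k)) ⟩
    ∑[ v < n ] (c v * at₃ v)                    ∎

module _ {n} (h : Fin n → Fin n → ℕ) where

  ordered : Fin n → Fin n → ℕ
  ordered x y = 𝟙 ⌊ x <? y ⌋ * h x y

  ordered-diagonal : ∀ x → ordered x x ≡ 0
  ordered-diagonal x with x <? x
  ... | yes x<x = ⊥-elim (<-irrefl refl x<x)
  ... | no  _   = refl

  module _ (h-sym : ∀ x y → h x y ≡ h y x) where

    ordered-pair : ∀ {x y} → x ≢ y → ordered x y + ordered y x ≡ h x y
    ordered-pair {x} {y} x≢y with x <? y | y <? x
    ... | yes x<y | yes y<x = ⊥-elim (<-asym x<y y<x)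
    ... | yes _   | no  _   = trans (+-identityʳ _) (*-identityˡ _)
    ... | no  _   | yes _   = trans (*-identityˡ _) (h-sym y x)
    ... | no  x≮y | no  y≮x with <-cmp x y
    ...   | tri< x<y _   _   = ⊥-elim (x≮y x<y)
    ...   | tri≈ _   x≡y _   = ⊥-elim (x≢y x≡y)
    ...   | tri> _   _   y<x = ⊥-elim (y≮x y<x)

    sum-ordered-pairs₃ : ∀ {a b c} → Unique (a ∷ b ∷ c ∷ []) →
                         (∀ x y → x ∉ a ∷ b ∷ c ∷ [] → h x y ≡ 0) →
                         ∑[ j < n ] ∑[ k < n ] ordered j k ≡ h a b + h a c + h b c
    sum-ordered-pairs₃ {a} {b} {c} !abc@((a≢b ∷ a≢c ∷ []) ∷ (b≢c ∷ []) ∷ [] ∷ []) h≡0 = begin-equality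
      ∑[ j < n ] ∑[ k < n ] ordered j k
        ≡⟨ sum-support !abc (λ j j∉abc → sum-zero (λ k → ordered≡0 j k (h≡0 j k j∉abc))) ⟩
      sumₗ (map (λ j → ∑[ k < n ] ordered j k) abc)
        ≡⟨ cong sumₗ (map-cong (λ j → sum-support !abc (λ k k∉abc → ordered≡0 j k (h≡0′ j k k∉abc))) abc) ⟩
      sumₗ (map (λ j → sumₗ (map (ordered j) abc)) abc)
        ≡⟨ regroup (ordered a a) (ordered a b) (ordered a c) (ordered b a) (ordered b b)
                   (ordered b c) (ordered c a) (ordered c b) (ordered c c) ⟩
      (ordered a a + ordered b b + ordered c c)
        + ((ordered a b + ordered b a) + (ordered a c + ordered c a) + (ordered b c + ordered c b))
        ≡⟨ cong₂ _+_ diagonal≡0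
                     (cong₂ _+_ (cong₂ _+_ (ordered-pair a≢b) (ordered-pair a≢c)) (ordered-pair b≢c)) ⟩
      h a b + h a c + h b c ∎
      where
      abc = a ∷ b ∷ c ∷ []
      h≡0′ : ∀ x y → y ∉ abc → h x y ≡ 0
      h≡0′ x y y∉abc = trans (h-sym x y) (h≡0 y x y∉abc)
      ordered≡0 : ∀ x y → h x y ≡ 0 → ordered x y ≡ 0
      ordered≡0 x y hxy≡0 = trans (cong (𝟙 ⌊ x <? y ⌋ *_) hxy≡0) (*-zeroʳ (𝟙 ⌊ x <? y ⌋))
      diagonal≡0 : ordered a a + ordered b b + ordered c c ≡ 0
      diagonal≡0 = cong₂ _+_ (cong₂ _+_ (ordered-diagonal a) (ordered-diagonal b)) (ordered-diagonal c)
      regroup : ∀ aa ab ac ba bb bc ca cb cc →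
        (aa + (ab + (ac + 0))) + ((ba + (bb + (bc + 0))) + ((ca + (cb + (cc + 0))) + 0))
        ≡ (aa + bb + cc) + ((ab + ba) + (ac + ca) + (bc + cb))
      regroup = solve-∀

length≡3 : ∀ {A : Set} {xs : List A} → length xs ≡ 3 → ∃[ a ] ∃[ b ] ∃[ c ] xs ≡ a ∷ b ∷ c ∷ []
length≡3 {xs = a ∷ b ∷ c ∷ []} refl = a , b , c , refl

distinct₃ : ∀ {A : Set} {a b c : A} → a ≢ b → a ≢ c → b ≢ c → Unique (a ∷ b ∷ c ∷ [])
distinct₃ a≢b a≢c b≢c = (a≢b ∷ a≢c ∷ []) ∷ (b≢c ∷ []) ∷ [] ∷ []

elements : ∀ {n} → (Fin n → Bool) → List (Fin n)
elements {n} p = filter (T? ∘ p) (allFin n)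

module _ {n} (p : Fin n → Bool) where

  elements-unique : Unique (elements p)
  elements-unique = filter⁺ (T? ∘ p) (allFin⁺ n)

  ∈-elements⁺ : ∀ {x} → T (p x) → x ∈ elements p
  ∈-elements⁺ {x} = ∈-filter⁺ (T? ∘ p) (∈-allFin x)

  ∈-elements⁻ : ∀ {x} → x ∈ elements p → T (p x)
  ∈-elements⁻ = proj₂ ∘ ∈-filter⁻ (T? ∘ p) {xs = allFin n}

  -- countFin filters with its own decision procedure for T, hence filter-≐ rather than refl.
  countFin≡length : countFin p ≡ length (elements p)
  countFin≡length = cong length (filter-≐ _ (T? ∘ p) (id , id) (allFin n))

  countFin≡sum : countFin p ≡ sum (𝟙 ∘ p)
  countFin≡sum = trans countFin≡length (trans (length-filter (allFin n)) (sumₗ-allFin (𝟙 ∘ p)))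
    where
    length-filter : ∀ xs → length (filter (T? ∘ p) xs) ≡ sumₗ (map (𝟙 ∘ p) xs)
    length-filter []       = refl
    length-filter (x ∷ xs) with p x
    ... | true  = cong suc (length-filter xs)
    ... | false = length-filter xs

  length-≤-countFin : ∀ {xs} → Unique xs → All (T ∘ p) xs → length xs ≤ countFin p
  length-≤-countFin !xs pxs = subst₂ _≤_ (sumₗ-ones pxs) (sym countFin≡sum) (sumₗ-≤-sum !xs (𝟙 ∘ p))
    where
    sumₗ-ones : ∀ {ys} → All (T ∘ p) ys → sumₗ (map (𝟙 ∘ p) ys) ≡ length ys
    sumₗ-ones []                 = refl
    sumₗ-ones {y ∷ _} (py ∷ pys) with p y
    ... | true = cong suc (sumₗ-ones pys)

-- 6 / κ: what each of the κ vertices of degree 3 of a triangle receives from its charge 6.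
w : ℕ → ℕ
w 1 = 6
w 2 = 3
w 3 = 2
w _ = 0

w-share : ∀ {κ} → 1 ≤ κ → κ ≤ 3 → κ * w κ ≡ 6
w-share {1} _ _ = refl
w-share {2} _ _ = refl
w-share {3} _ _ = refl
w-share {suc (suc (suc (suc _)))} _ (s≤s (s≤s (s≤s ())))

w≤6 : ∀ κ → w κ ≤ 6
w≤6 0 = z≤n
w≤6 1 = ≤-refl
w≤6 2 = s≤s (s≤s (s≤s z≤n))
w≤6 3 = s≤s (s≤s z≤n)
w≤6 (suc (suc (suc (suc _)))) = z≤n

w≤3 : ∀ {κ} → 2 ≤ κ → w κ ≤ 3
w≤3 {1} (s≤s ())
w≤3 {2} _ = ≤-refl
w≤3 {3} _ = s≤s (s≤s z≤n)
w≤3 {suc (suc (suc (suc _)))} _ = z≤n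

2≤1+1+d : ∀ d → 2 ≤ 1 + 1 + d
2≤1+1+d _ = s≤s (s≤s z≤n)

2≤1+d+1 : ∀ d → 2 ≤ 1 + d + 1
2≤1+d+1 d = +-monoˡ-≤ 1 (s≤s {n = d} z≤n)

shares-of-three-edges-≤-6 : ∀ xab xac xbc {da db dc} →
  (T xab → T xac → da ≡ 1) → (T xab → T xbc → db ≡ 1) → (T xac → T xbc → dc ≡ 1) →
  𝟙 xab * w (1 + da + db) + 𝟙 xac * w (1 + da + dc) + 𝟙 xbc * w (1 + db + dc) ≤ 6
shares-of-three-edges-≤-6 false false false _ _ _ = z≤n
shares-of-three-edges-≤-6 true  false false _ _ _ = +-mono₃-≤ 6 0 0 (𝟙-*-≤ true (w≤6 _)) z≤n z≤n
shares-of-three-edges-≤-6 false true  false _ _ _ = +-mono₃-≤ 0 6 0 z≤n (𝟙-*-≤ true (w≤6 _)) z≤n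
shares-of-three-edges-≤-6 false false true  _ _ _ = +-mono₃-≤ 0 0 6 z≤n z≤n (𝟙-*-≤ true (w≤6 _))
shares-of-three-edges-≤-6 true  true  false {db = db} {dc} a _ _ rewrite a _ _ =
  +-mono₃-≤ 3 3 0 (𝟙-*-≤ true (w≤3 (2≤1+1+d db))) (𝟙-*-≤ true (w≤3 (2≤1+1+d dc))) z≤n
shares-of-three-edges-≤-6 true  false true  {da} {dc = dc} _ b _ rewrite b _ _ =
  +-mono₃-≤ 3 0 3 (𝟙-*-≤ true (w≤3 (2≤1+d+1 da))) z≤n (𝟙-*-≤ true (w≤3 (2≤1+1+d dc)))
shares-of-three-edges-≤-6 false true  true  {da} {db} _ _ c rewrite c _ _ =
  +-mono₃-≤ 0 3 3 z≤n (𝟙-*-≤ true (w≤3 (2≤1+d+1 da))) (𝟙-*-≤ true (w≤3 (2≤1+d+1 db)))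
shares-of-three-edges-≤-6 true  true  true  a b c rewrite a _ _ | b _ _ | c _ _ = ≤-refl

module _ {n} (G : Graph n) where

  Adj-sym : ∀ {u v} → Adj G u v → Adj G v u
  Adj-sym {u} {v} = subst T (adj-sym G u v)

  Adj⇒≢ : ∀ {u v} → Adj G u v → u ≢ v
  Adj⇒≢ {u} uu refl = subst T (adj-irrefl G u) uu

  walk-closed : {P : Fin n → Set} → (∀ {x y} → Adj G x y → P x → P y) →
                ∀ {x y} → Walk G x y → P x → P y
  walk-closed closed here         px = px
  walk-closed closed (step xz zy) px = walk-closed closed zy (closed xz px)

  neighbours : Fin n → List (Fin n)
  neighbours v = elements (adj G v)

  degree≡3⇒neighbours : ∀ {v} → degree G v ≡ 3 → ∃[ a ] ∃[ b ] ∃[ c ] neighbours v ≡ a ∷ b ∷ c ∷ []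
  degree≡3⇒neighbours {v} deg≡3 = length≡3 (trans (sym (countFin≡length (adj G v))) deg≡3)

  three-neighbours⇒3≤degree : ∀ {v x y z} → Adj G v x → Adj G v y → Adj G v z →
                              Unique (x ∷ y ∷ z ∷ []) → 3 ≤ degree G v
  three-neighbours⇒3≤degree {v} vx vy vz !xyz = length-≤-countFin (adj G v) !xyz (vx ∷ vy ∷ vz ∷ [])

  isTriangle⁻ : ∀ i j k → T (isTriangle G i j k) →
                i <ᶠ j × j <ᶠ k × Adj G i j × Adj G j k × Adj G i k
  isTriangle⁻ i j k t with i <? j | j <? k | adj G i j | adj G j k | adj G i k
  ... | yes i<j | yes j<k | true  | true  | true  = i<j , j<k , _ , _ , _
  ... | no  _   | _       | _     | _     | _     = ⊥-elim t
  ... | yes _   | no  _   | _     | _     | _     = ⊥-elim t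
  ... | yes _   | yes _   | false | _     | _     = ⊥-elim t
  ... | yes _   | yes _   | true  | false | _     = ⊥-elim t
  ... | yes _   | yes _   | true  | true  | false = ⊥-elim t

  formsTriangle : Fin n → Fin n → Fin n → Bool
  formsTriangle v j k = adj G v j ∧ adj G v k ∧ adj G j k

  triangle : Fin n → Fin n → Fin n → ℕ
  triangle i j k = 𝟙 (isTriangle G i j k)

  numTriangles≡sum³ : numTriangles G ≡ sum³ triangle
  numTriangles≡sum³ =
    trans (sumₗ-allFin (λ i → sumₗ (map (λ j → countFin (isTriangle G i j)) (allFin n)))) (sum-cong-≗ λ i →
    trans (sumₗ-allFin (λ j → countFin (isTriangle G i j))) (sum-cong-≗ λ j → countFin≡sum (isTriangle G i j)))

  -- At most one rotation of (v, j, k) lists the vertices in increasing order.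
  rotations-≤ : ∀ v j k →
                triangle v j k + triangle j v k + triangle j k v ≤ 𝟙 ⌊ j <? k ⌋ * 𝟙 (formsTriangle v j k)
  rotations-≤ v j k =
    subst (triangle v j k + triangle j v k + triangle j k v ≤_) (𝟙-∧ ⌊ j <? k ⌋ (formsTriangle v j k))
          (𝟙-at-most-one-≤ vjk jvk jkv vjk∧jvk vjk∧jkv jvk∧jkv)
    where
    Forms = T (⌊ j <? k ⌋ ∧ formsTriangle v j k)
    forms : j <ᶠ k → Adj G v j → Adj G v k → Adj G j k → Forms
    forms j<k vj vk jk =
      Equivalence.from (T-∧ {⌊ j <? k ⌋}) (fromWitness j<k ,
      Equivalence.from (T-∧ {adj G v j}) (vj ,
      Equivalence.from (T-∧ {adj G v k}) (vk , jk)))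
    vjk : T (isTriangle G v j k) → Forms
    vjk t = let _ , j<k , vj , jk , vk = isTriangle⁻ v j k t in forms j<k vj vk jk
    jvk : T (isTriangle G j v k) → Forms
    jvk t = let j<v , v<k , jv , vk , jk = isTriangle⁻ j v k t in forms (<-trans j<v v<k) (Adj-sym jv) vk jk
    jkv : T (isTriangle G j k v) → Forms
    jkv t = let j<k , _ , jk , kv , jv = isTriangle⁻ j k v t in forms j<k (Adj-sym jv) (Adj-sym kv) jk
    vjk∧jvk : T (isTriangle G v j k) → T (isTriangle G j v k) → ⊥
    vjk∧jvk t t′ = <-asym (proj₁ (isTriangle⁻ v j k t)) (proj₁ (isTriangle⁻ j v k t′))
    vjk∧jkv : T (isTriangle G v j k) → T (isTriangle G j k v) → ⊥
    vjk∧jkv t t′ = let v<j , _ = isTriangle⁻ v j k t ; j<k , k<v , _ = isTriangle⁻ j k v t′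
                   in <-asym (<-trans v<j j<k) k<v
    jvk∧jkv : T (isTriangle G j v k) → T (isTriangle G j k v) → ⊥
    jvk∧jkv t t′ = <-asym (proj₁ (proj₂ (isTriangle⁻ j v k t))) (proj₁ (proj₂ (isTriangle⁻ j k v t′)))

  deg3 : Fin n → ℕ
  deg3 v = 𝟙 ⌊ degree G v ≟ℕ 3 ⌋

  numDegree3≡sum : numDegree G 3 ≡ ∑[ v < n ] deg3 v
  numDegree3≡sum = countFin≡sum (λ v → ⌊ degree G v ≟ℕ 3 ⌋)

  deg3≤1 : ∀ v → deg3 v ≤ 1
  deg3≤1 v with degree G v ≟ℕ 3
  ... | yes _ = ≤-refl
  ... | no  _ = z≤n

  deg3≡1⇒degree≡3 : ∀ {v} → deg3 v ≡ 1 → degree G v ≡ 3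
  deg3≡1⇒degree≡3 {v} d≡1 with degree G v ≟ℕ 3
  ... | yes deg≡3 = deg≡3
  ... | no  _     = ⊥-elim (0≢1+n d≡1)

  degree≡3⇒deg3≡1 : ∀ {v} → degree G v ≡ 3 → deg3 v ≡ 1
  degree≡3⇒deg3≡1 {v} deg≡3 with degree G v ≟ℕ 3
  ... | yes _     = refl
  ... | no  deg≢3 = ⊥-elim (deg≢3 deg≡3)

  κ : Fin n → Fin n → Fin n → ℕ
  κ i j k = deg3 i + deg3 j + deg3 k

  κ≤3 : ∀ i j k → κ i j k ≤ 3
  κ≤3 i j k = +-mono₃-≤ 1 1 1 (deg3≤1 i) (deg3≤1 j) (deg3≤1 k)

  share : Fin n → Fin n → Fin n → ℕ
  share i j k = triangle i j k * w (κ i j k)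

  shareAt : Fin n → Fin n → Fin n → ℕ
  shareAt v j k = 𝟙 (formsTriangle v j k) * w (κ v j k)

  shareAt-sym : ∀ v j k → shareAt v j k ≡ shareAt v k j
  shareAt-sym v j k =
    cong₂ (λ b d → 𝟙 b * w d) formsTriangle-sym (xy∙z≈xz∙y +-commutativeSemigroup (deg3 v) (deg3 j) (deg3 k))
    where
    formsTriangle-sym : formsTriangle v j k ≡ formsTriangle v k j
    formsTriangle-sym rewrite adj-sym G j k with adj G v j | adj G v k
    ... | true  | true  = refl
    ... | true  | false = refl
    ... | false | true  = refl
    ... | false | false = refl

  shares-≤-shareAt : ∀ v j k → share v j k + share j v k + share j k v ≤ ordered (shareAt v) j k
  shares-≤-shareAt v j k = begin
    share v j k + share j v k + share j k v
      ≡⟨ cong₂ (λ κ₂ κ₃ → share v j k + triangle j v k * w κ₂ + triangle j k v * w κ₃) κ-swap κ-rotate ⟩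
    triangle v j k * wᵥ + triangle j v k * wᵥ + triangle j k v * wᵥ
      ≡⟨ trans (*-distribʳ-+ wᵥ (triangle v j k + triangle j v k) (triangle j k v))
               (cong (_+ triangle j k v * wᵥ) (*-distribʳ-+ wᵥ (triangle v j k) (triangle j v k))) ⟨
    (triangle v j k + triangle j v k + triangle j k v) * wᵥ
      ≤⟨ *-monoˡ-≤ wᵥ (rotations-≤ v j k) ⟩
    𝟙 ⌊ j <? k ⌋ * 𝟙 (formsTriangle v j k) * wᵥ
      ≡⟨ *-assoc (𝟙 ⌊ j <? k ⌋) (𝟙 (formsTriangle v j k)) wᵥ ⟩
    ordered (shareAt v) j k ∎
    where
    wᵥ = w (κ v j k)
    κ-swap : κ j v k ≡ κ v j k
    κ-swap = cong (_+ deg3 k) (+-comm (deg3 j) (deg3 v))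
    κ-rotate : κ j k v ≡ κ v j k
    κ-rotate = trans (+-comm (deg3 j + deg3 k) (deg3 v)) (sym (+-assoc (deg3 v) (deg3 j) (deg3 k)))

  received : Fin n → ℕ
  received v = ∑[ j < n ] ∑[ k < n ] ordered (shareAt v) j k

module _ {n} (G : Graph n) (maxdeg : ∀ v → degree G v ≤ 3) where

  three-neighbours⇒deg3≡1 : ∀ {v x y z} → Adj G v x → Adj G v y → Adj G v z →
                            Unique (x ∷ y ∷ z ∷ []) → deg3 G v ≡ 1
  three-neighbours⇒deg3≡1 {v} vx vy vz !xyz =
    degree≡3⇒deg3≡1 G (≤-antisym (maxdeg v) (three-neighbours⇒3≤degree G vx vy vz !xyz))

  other-neighbours : ∀ {x a b y} → deg3 G x ≡ 0 → Adj G x a → Adj G x b → a ≢ b → Adj G x y → y ≡ a ⊎ y ≡ b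
  other-neighbours {a = a} {b} {y} x≢3 xa xb a≢b xy with y ≟ a | y ≟ b
  ... | yes y≡a | _       = inj₁ y≡a
  ... | no  _   | yes y≡b = inj₂ y≡b
  ... | no  y≢a | no  y≢b =
    ⊥-elim (0≢1+n (trans (sym x≢3) (three-neighbours⇒deg3≡1 xa xb xy (distinct₃ a≢b (y≢a ∘ sym) (y≢b ∘ sym)))))

  triangle-meets-degree-3 : Connected G → ∃[ u ] degree G u ≡ 3 →
                            ∀ {i j k} → Adj G i j → Adj G j k → Adj G i k → 1 ≤ κ G i j k
  triangle-meets-degree-3 (_ , walk) (u , deg-u≡3) {i} {j} {k} ij jk ik =
    positive (deg3 G i) (deg3 G j) (deg3 G k) isolated
    where
    positive : ∀ a b c → (a ≡ 0 → b ≡ 0 → c ≡ 0 → ⊥) → 1 ≤ a + b + c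
    positive (suc _) _       _       _ = s≤s z≤n
    positive zero    (suc _) _       _ = s≤s z≤n
    positive zero    zero    (suc _) _ = s≤s z≤n
    positive zero    zero    zero    h = ⊥-elim (h refl refl refl)

    OnTriangle : Fin n → Set
    OnTriangle x = x ≡ i ⊎ x ≡ j ⊎ x ≡ k

    isolated : deg3 G i ≡ 0 → deg3 G j ≡ 0 → deg3 G k ≡ 0 → ⊥
    isolated i≢3 j≢3 k≢3 = 0≢1+n (trans (sym (low-degree (walk-closed G closed (walk i u) (inj₁ refl))))
                                       (degree≡3⇒deg3≡1 G deg-u≡3))
      where
      closed : ∀ {x y} → Adj G x y → OnTriangle x → OnTriangle y
      closed xy (inj₁ refl)        = inj₂ (other-neighbours i≢3 ij ik (Adj⇒≢ G jk) xy)
      closed xy (inj₂ (inj₁ refl)) = map₂ inj₂ (other-neighbours j≢3 (Adj-sym G ij) jk (Adj⇒≢ G ik) xy)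
      closed xy (inj₂ (inj₂ refl)) =
        map₂ inj₁ (other-neighbours k≢3 (Adj-sym G ik) (Adj-sym G jk) (Adj⇒≢ G ij) xy)
      low-degree : ∀ {x} → OnTriangle x → deg3 G x ≡ 0
      low-degree (inj₁ refl)        = i≢3
      low-degree (inj₂ (inj₁ refl)) = j≢3
      low-degree (inj₂ (inj₂ refl)) = k≢3

  received-≤-6 : ∀ {v} → degree G v ≡ 3 → received G v ≤ 6
  received-≤-6 {v} deg≡3 with degree≡3⇒neighbours G deg≡3
  ... | a , b , c , N≡abc = received-≤-6-at (subst Unique N≡abc (elements-unique (adj G v)))
    where
    adjacent : ∀ {x} → x ∈ a ∷ b ∷ c ∷ [] → Adj G v x
    adjacent x∈abc = ∈-elements⁻ (adj G v) (subst (_ ∈_) (sym N≡abc) x∈abc)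

    outside : ∀ x y → x ∉ a ∷ b ∷ c ∷ [] → shareAt G v x y ≡ 0
    outside x y x∉abc with adj G v x in vx
    ... | false = refl
    ... | true  = ⊥-elim (x∉abc (subst (x ∈_) N≡abc (∈-elements⁺ (adj G v) (subst T (sym vx) _))))

    shareAt-neighbours : ∀ {x y} → Adj G v x → Adj G v y →
                         shareAt G v x y ≡ 𝟙 (adj G x y) * w (1 + deg3 G x + deg3 G y)
    shareAt-neighbours {x} {y} vx vy with adj G v x | adj G v y
    ... | true | true = cong (λ d → 𝟙 (adj G x y) * w (d + deg3 G x + deg3 G y)) (degree≡3⇒deg3≡1 G deg≡3)

    received-≤-6-at : Unique (a ∷ b ∷ c ∷ []) → received G v ≤ 6
    received-≤-6-at !abc@((a≢b ∷ a≢c ∷ []) ∷ (b≢c ∷ []) ∷ [] ∷ []) = begin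
      received G v
        ≡⟨ sum-ordered-pairs₃ (shareAt G v) (shareAt-sym G v) !abc outside ⟩
      shareAt G v a b + shareAt G v a c + shareAt G v b c
        ≡⟨ cong₂ _+_ (cong₂ _+_ (shareAt-neighbours va vb) (shareAt-neighbours va vc))
                     (shareAt-neighbours vb vc) ⟩
      𝟙 (adj G a b) * w (1 + deg3 G a + deg3 G b) + 𝟙 (adj G a c) * w (1 + deg3 G a + deg3 G c)
        + 𝟙 (adj G b c) * w (1 + deg3 G b + deg3 G c)
        ≤⟨ shares-of-three-edges-≤-6 (adj G a b) (adj G a c) (adj G b c) shared-a shared-b shared-c ⟩
      6 ∎
      where
      va = adjacent (here refl)
      vb = adjacent (there (here refl))
      vc = adjacent (there (there (here refl)))
      shared-a : Adj G a b → Adj G a c → deg3 G a ≡ 1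
      shared-a ab ac =
        three-neighbours⇒deg3≡1 (Adj-sym G va) ab ac (distinct₃ (Adj⇒≢ G vb) (Adj⇒≢ G vc) b≢c)
      shared-b : Adj G a b → Adj G b c → deg3 G b ≡ 1
      shared-b ab bc =
        three-neighbours⇒deg3≡1 (Adj-sym G vb) (Adj-sym G ab) bc (distinct₃ (Adj⇒≢ G va) (Adj⇒≢ G vc) a≢c)
      shared-c : Adj G a c → Adj G b c → deg3 G c ≡ 1
      shared-c ac bc = three-neighbours⇒deg3≡1 (Adj-sym G vc) (Adj-sym G ac) (Adj-sym G bc)
                                               (distinct₃ (Adj⇒≢ G va) (Adj⇒≢ G vb) a≢b)

  module _ (connected : Connected G) (has-degree-3 : ∃[ u ] degree G u ≡ 3) where

    κ*share≡6*triangle : ∀ i j k → κ G i j k * share G i j k ≡ 6 * triangle G i j k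
    κ*share≡6*triangle i j k with isTriangle G i j k in t
    ... | false = *-zeroʳ (κ G i j k)
    ... | true  = let _ , _ , ij , jk , ik = isTriangle⁻ G i j k (subst T (sym t) _) in
      trans (cong (κ G i j k *_) (*-identityˡ (w (κ G i j k))))
            (w-share (triangle-meets-degree-3 connected has-degree-3 ij jk ik) (κ≤3 G i j k))

    deg3*collected-≤ : ∀ v → deg3 G v * ∑[ j < n ] ∑[ k < n ] (share G v j k + share G j v k + share G j k v)
                             ≤ deg3 G v * 6
    deg3*collected-≤ v = ≤1⇒*-monoʳ-≤ (deg3≤1 G v) λ d≡1 →
      ≤-trans (sum-mono-≤ (λ j → sum-mono-≤ (shares-≤-shareAt G v j))) (received-≤-6 (deg3≡1⇒degree≡3 G d≡1))

    six-triangles-≤ : 6 * numTriangles G ≤ 6 * numDegree G 3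
    six-triangles-≤ = begin
      6 * numTriangles G
        ≡⟨ cong (6 *_) (numTriangles≡sum³ G) ⟩
      6 * sum³ (triangle G)
        ≡⟨ sum³-pull 6 (triangle G) ⟨
      sum³ (λ i j k → 6 * triangle G i j k)
        ≡⟨ sum³-cong κ*share≡6*triangle ⟨
      sum³ (λ i j k → κ G i j k * share G i j k)
        ≡⟨ sum-redistribute (deg3 G) (share G) ⟩
      ∑[ v < n ] (deg3 G v * ∑[ j < n ] ∑[ k < n ] (share G v j k + share G j v k + share G j k v))
        ≤⟨ sum-mono-≤ deg3*collected-≤ ⟩
      ∑[ v < n ] (deg3 G v * 6)
        ≡⟨ trans (sum-cong-≗ (λ v → *-comm (deg3 G v) 6)) (sym (*-distribˡ-sum 6 (deg3 G))) ⟩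
      6 * ∑[ v < n ] deg3 G v
        ≡⟨ cong (6 *_) (numDegree3≡sum G) ⟨
      6 * numDegree G 3 ∎

corollary3 : ∀ {n} (H : Graph n) → Connected H → MaxDegree H 3 →
    2 ≤ numTriangles H → numTriangles H ≤ numDegree H 3
corollary3 H connected (maxdeg , has-degree-3) _ =
  *-cancelˡ-≤ 6 (six-triangles-≤ H maxdeg connected has-degree-3)
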